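{- Let $G$ be a graph, $T \subseteq V(G)$, and $x\in V(G)$ such that $\{x\}$ is a multiway near-separator of $(G,T)$. Let $\mathcal{F}$ be a rooted block-cut forest of $G-\{x\}$, let $t \in T$ be a cut vertex node of $\mathcal{F}$, and let $\mathcal{C}_{\ge 1}(t)$ be as defined below. Let $B$ be a node of the subtree $\mathcal{F}_t$ such that the graph $G[V_G(\mathcal{F}_B)\cup\{x\}]$ contains no $T$-cycle. Then $|V_G(\mathcal{F}_B)\cap \mathcal{C}_{\ge1}(t)| \le 1$.
   Context: All graphs are finite, simple and undirected. Given $G$ and $T\subseteq V(G)$, a set $S\subseteq V(G)$ is a multiway near-separator of $(G,T)$ if $S\cap T=\emptyset$ and no pair of distinct $t_i,t_j\in T$ is joined by two internally vertex-disjoint paths in $G-S$ (an edge $t_it_j$ counts as two such paths). A $T$-cycle is a cycle containing at least two vertices of $T$. A block of a graph is a maximal connected subgraph without a cut vertex; the block-cut graph has as nodes the cut vertices and blocks, a cut vertex $a$ adjacent to block $B$ iff $a\in V(B)$. A rooted block-cut forest consists of the block-cut trees of the connected components, each rooted at an arbitrary block. For a node $d$ of $\mathcal{F}$, $\mathcal{F}_d$ is the subtree rooted at $d$, $V_G(\mathcal{F}_d)$ is the set of vertices of $G$ occurring in blocks of $\mathcal{F}_d$, and $G_d = G[V_G(\mathcal{F}_d)]$. For a cut vertex $v$, $\mathcal{C}(v)$ is the set of grandchildren of $v$ in $\mathcal{F}$ (children of children of $v$), and $\mathcal{C}_{\ge1}(v)\subseteq\mathcal{C}(v)$ is the set of those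 $c\in\mathcal{C}(v)$ such that $G_c$ contains a vertex $p \in N_G(x)$ and a $c$-$p$ path in $G_c$ containing at least one vertex of $T$. -}

module Defs where

open import Level using (0ℓ)
open import Data.Nat using (ℕ; _≤_)
open import Data.Fin using (Fin)
open import Data.Fin.Subset using (Subset; _∈_; _∉_; _⊆_; Nonempty)
open import Data.List using (List; head; last; length)
open import Data.List.Relation.Unary.All using (All)
open import Data.List.Relation.Unary.Linked using (Linked)
open import Data.List.Relation.Unary.Unique.Propositional using (Unique)
import Data.List.Membership.Propositional as LM
open import Data.Maybe using (just)
open import Data.Product using (Σ; _×_; ∃)
open import Data.Sum using (_⊎_)
open import Data.Empty using (⊥)
open import Relation.Nullary using (¬_; Dec)
open import Relation.Binary.PropositionalEquality using (_≡_; _≢_)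

record Graph (n : ℕ) : Set₁ where
  field
    Adj    : Fin n → Fin n → Set
    adj?   : ∀ u v → Dec (Adj u v)
    sym    : ∀ {u v} → Adj u v → Adj v u
    irrefl : ∀ {u} → ¬ Adj u u

-- A set of vertices given as a predicate (used for induced subgraphs G[H]).
VSet : ℕ → Set₁
VSet n = Fin n → Set

_∖₁_ : ∀ {n} → VSet n → Fin n → VSet n
(H ∖₁ v) u = H u × u ≢ v

⟦_⟧ : ∀ {n} → Subset n → VSet n
⟦ S ⟧ v = v ∈ S

-- Nodes of a block-cut forest: cut vertices and blocks (blocks given by vertex set).
data Node (n : ℕ) : Set where
  cut : Fin n → Node n
  blk : Subset n → Node n

module _ {n : ℕ} (G : Graph n) where
  open Graph G

  record Walk (H : VSet n) (u w : Fin n) : Set where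
    field
      verts  : List (Fin n)
      start  : head verts ≡ just u
      end    : last verts ≡ just w
      inH    : All H verts
      linked : Linked Adj verts

  record Path (H : VSet n) (u w : Fin n) : Set where
    field
      walk     : Walk H u w
      distinct : Unique (Walk.verts walk)

  pverts : ∀ {H u w} → Path H u w → List (Fin n)
  pverts P = Walk.verts (Path.walk P)

  IsCutVertex : VSet n → Fin n → Set
  IsCutVertex H v =
    H v × Σ (Fin n) λ u → Σ (Fin n) λ w →
      H u × H w × u ≢ v × w ≢ v × Walk H u w × ¬ Walk (H ∖₁ v) u w

  -- a and b are joined by two internally vertex-disjoint paths in G[H]
  -- (an edge ab counts as two such paths)
  TwoDisjointPaths : VSet n → Fin n → Fin n → Set
  TwoDisjointPaths H a b =
    Adj a b ⊎
    Σ (Path H a b) λ P → Σ (Path H a b) λ Q →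
      pverts P ≢ pverts Q ×
      (∀ v → v LM.∈ pverts P → v LM.∈ pverts Q → v ≡ a ⊎ v ≡ b)

  MultiwayNearSeparator : Subset n → VSet n → Set
  MultiwayNearSeparator T S =
    (∀ v → S v → v ∉ T) ×
    (∀ a b → a ∈ T → b ∈ T → a ≢ b → ¬ TwoDisjointPaths (λ v → ¬ S v) a b)

  IsCycle : VSet n → List (Fin n) → Set
  IsCycle H cs =
    3 ≤ length cs × Unique cs × All H cs × Linked Adj cs ×
    Σ (Fin n) λ a → Σ (Fin n) λ b → last cs ≡ just a × head cs ≡ just b × Adj a b

  HasTCycle : Subset n → VSet n → Set
  HasTCycle T H =
    Σ (List (Fin n)) λ cs → IsCycle H cs ×
      Σ (Fin n) λ a → Σ (Fin n) λ b →
        a LM.∈ cs × b LM.∈ cs × a ≢ b × a ∈ T × b ∈ T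

  ConnNoCut : VSet n → Subset n → Set
  ConnNoCut H S =
    (∀ v → v ∈ S → H v) ×
    (∀ u w → u ∈ S → w ∈ S → Walk ⟦ S ⟧ u w) ×
    (∀ v → ¬ IsCutVertex ⟦ S ⟧ v)

  IsBlock : VSet n → Subset n → Set
  IsBlock H S = Nonempty S × ConnNoCut H S × (∀ S' → S ⊆ S' → ConnNoCut H S' → S' ⊆ S)

  ValidNode : VSet n → Node n → Set
  ValidNode H (cut v) = IsCutVertex H v
  ValidNode H (blk S) = IsBlock H S

  BCAdj : Node n → Node n → Set
  BCAdj (cut a) (blk S) = a ∈ S
  BCAdj (blk S) (cut a) = a ∈ S
  BCAdj _ _ = ⊥

  record BCWalk (H : VSet n) (d e : Node n) : Set where
    field
      nodes  : List (Node n)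
      start  : head nodes ≡ just d
      end    : last nodes ≡ just e
      valid  : All (ValidNode H) nodes
      linked : Linked BCAdj nodes

  -- a rooted block-cut forest of G[H]: one root block in each component
  record Rooting (H : VSet n) : Set₁ where
    field
      Root      : Subset n → Set
      rootBlock : ∀ S → Root S → IsBlock H S
      reach     : ∀ d → ValidNode H d → Σ (Subset n) λ S → Root S × BCWalk H d (blk S)
      unique    : ∀ S S' → Root S → Root S' → BCWalk H (blk S) (blk S') → S ≡ S'

  module _ (H : VSet n) (R : Rooting H) where
    open Rooting R

    -- d is a node of the subtree F_e: e lies on every path from d to the root
    InSubtree : Node n → Node n → Set
    InSubtree d e =
      ValidNode H d × ValidNode H e ×
      (∀ S → Root S → (w : BCWalk H d (blk S)) → e LM.∈ BCWalk.nodes w)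

    Child : Node n → Node n → Set
    Child c d = InSubtree c d × BCAdj d c

    Grandchild : Node n → Node n → Set
    Grandchild g d = Σ (Node n) λ c → Child c d × Child g c

    VG : Node n → VSet n
    VG d v = Σ (Subset n) λ S → InSubtree (blk S) d × v ∈ S

    -- c ∈ 𝒞_{≥1}(t) (grandchildren of a cut vertex are cut vertices)
    InC≥1 : Subset n → Fin n → Fin n → Fin n → Set
    InC≥1 T x t c =
      Grandchild (cut c) (cut t) ×
      Σ (Fin n) λ p → VG (cut c) p × Adj p x ×
        Σ (Path (VG (cut c)) c p) λ P → Σ (Fin n) λ v → v LM.∈ pverts P × v ∈ T

-- Suppose c ≠ c' both lie in 𝒞≥1(t) ∩ V_G(𝓕_B), below the children S₁ and S₂ of t.  The
-- vertex sets of G_c and G_c' are disjoint, and G_c meets a child block of t only in c.  As c and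
-- c' lie in 𝓕_B but 𝓕_c and 𝓕_c' are disjoint, S₁ and S₂ lie in 𝓕_B as well.  Then
-- x – p ⋯ c (in G_c, through a vertex of T), c ⋯ t ⋯ c' (in S₁ ∪ S₂) and c' ⋯ p' – x (in G_c')
-- close up to a T-cycle of G[V_G(𝓕_B) ∪ {x}].  Facts about blocks are obtained under double negation, which suffices since
-- c ≡ c' is decidable.

module Submission where

open import Defs
open import Data.Bool.Properties using () renaming (_≟_ to _≟ᴮ_)
open import Data.Empty using (⊥; ⊥-elim)
open import Data.Fin using (Fin)
open import Data.Fin.Properties using (_≟_)
open import Data.Fin.Subset using (Subset; _∈_; _∉_; _⊆_; ⁅_⁆; _∪_) renaming (⊥ to ∅)
open import Data.Fin.Subset.Properties using (_∈?_; ∉⊥; x∈⁅x⁆; x∈⁅y⁆⇒x≡y; x∈p∪q⁻; x∈p∪q⁺; ⊆-antisym)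
open import Data.List using (List; []; _∷_; _++_; length; head; last)
open import Data.List.Properties using (length-++)
open import Data.List.Relation.Unary.All as All using (All; []; _∷_)
open import Data.List.Relation.Unary.All.Properties using (¬Any⇒All¬)
open import Data.List.Relation.Unary.Any using (here; there)
open import Data.List.Relation.Unary.Linked using (Linked; [-]; _∷_)
open import Data.List.Relation.Unary.AllPairs using ([]; _∷_)
open import Data.List.Relation.Unary.Unique.Propositional using (Unique)
open import Data.List.Relation.Unary.Unique.Propositional.Properties as Unique using (Unique[x∷xs]⇒x∉xs)
open import Data.List.Relation.Binary.Disjoint.Propositional using (Disjoint)
open import Data.List.Relation.Binary.Subset.Propositional using () renaming (_⊆_ to _⊑_)
open import Data.List.Membership.Propositional using () renaming (_∈_ to _∈ᴸ_; _∉_ to _∉ᴸ_)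
open import Data.List.Membership.Propositional.Properties using (∈-++⁺ˡ; ∈-++⁺ʳ; ∈-++⁻)
open import Data.List.Membership.DecPropositional using () renaming (_∈?_ to _∈ᴸ?_)
open import Data.Maybe using (just)
open import Data.Nat using (ℕ; suc; _≤_; _<_; s≤s; z≤n)
open import Data.Nat.Properties using (≤-refl; ≤-trans; <-≤-trans; <⇒≤; ≤-pred; m≤n+m)
open import Data.Product using (Σ; ∃; _×_; _,_; proj₁; proj₂)
open import Data.Sum using (_⊎_; inj₁; inj₂; [_,_]′)
open import Function using (_∘_)
open import Data.Vec.Properties using (≡-dec)
open import Relation.Nullary using (¬_; yes; no)
open import Relation.Nullary.Negation.Core using (DoubleNegation)
open import Relation.Binary.Definitions using (DecidableEquality; Symmetric)
open import Relation.Binary.PropositionalEquality using (_≡_; _≢_; refl; sym; trans; cong; subst)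

module _ {A : Set} where

  private variable
    R : A → A → Set
    P Q : A → Set
    a b c v z : A

  Unique-++⇒Disjoint : ∀ (xs : List A) {ys} → Unique (xs ++ ys) → Disjoint xs ys
  Unique-++⇒Disjoint (_ ∷ xs) (x∉ ∷ _) (here refl , m) = All.lookup x∉ (∈-++⁺ʳ xs m) refl
  Unique-++⇒Disjoint (_ ∷ xs) (_ ∷ u)  (there m' , m)  = Unique-++⇒Disjoint xs u (m' , m)

  Unique-++⁻ʳ : ∀ (xs : List A) {ys} → Unique (xs ++ ys) → Unique ys
  Unique-++⁻ʳ []       u       = u
  Unique-++⁻ʳ (_ ∷ xs) (_ ∷ u) = Unique-++⁻ʳ xs u

  ∈∧∈⇒2≤length-++ : ∀ {xs ys : List A} → a ∈ᴸ xs → b ∈ᴸ ys → 2 ≤ length (xs ++ ys)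
  ∈∧∈⇒2≤length-++ {xs = _ ∷ []}    {ys = _ ∷ _} _ _ = s≤s (s≤s z≤n)
  ∈∧∈⇒2≤length-++ {xs = _ ∷ _ ∷ _}              _ _ = s≤s (s≤s z≤n)

  data Chain (R : A → A → Set) (P : A → Set) : A → A → Set where
    [_]    : P a → Chain R P a a
    _∷⟨_⟩_ : P a → R a b → Chain R P b c → Chain R P a c

  vertices : Chain R P a b → List A
  vertices {a = a} [ _ ]          = a ∷ []
  vertices {a = a} (_ ∷⟨ _ ⟩ ch) = a ∷ vertices ch

  tailVertices : Chain R P a b → List A
  tailVertices [ _ ]          = []
  tailVertices (_ ∷⟨ _ ⟩ ch) = vertices ch

  vertices≡∷tail : (ch : Chain R P a b) → vertices ch ≡ a ∷ tailVertices ch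
  vertices≡∷tail [ _ ]         = refl
  vertices≡∷tail (_ ∷⟨ _ ⟩ _) = refl

  tail⊑vertices : (ch : Chain R P a b) → tailVertices ch ⊑ vertices ch
  tail⊑vertices (_ ∷⟨ _ ⟩ _) m = there m

  tail-unique : (ch : Chain R P a b) → Unique (vertices ch) → Unique (tailVertices ch)
  tail-unique [ _ ]          _       = []
  tail-unique (_ ∷⟨ _ ⟩ _) (_ ∷ u) = u

  first∉tail : (ch : Chain R P a b) → Unique (vertices ch) → a ∉ᴸ tailVertices ch
  first∉tail ch u = Unique[x∷xs]⇒x∉xs (subst Unique (vertices≡∷tail ch) u)

  first∈ : (ch : Chain R P a b) → a ∈ᴸ vertices ch
  first∈ [ _ ]         = here refl
  first∈ (_ ∷⟨ _ ⟩ _) = here refl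

  last∈ : (ch : Chain R P a b) → b ∈ᴸ vertices ch
  last∈ [ _ ]          = here refl
  last∈ (_ ∷⟨ _ ⟩ ch) = there (last∈ ch)

  last∈tail : (ch : Chain R P a b) → a ≢ b → b ∈ᴸ tailVertices ch
  last∈tail [ _ ]          a≢b = ⊥-elim (a≢b refl)
  last∈tail (_ ∷⟨ _ ⟩ ch) _   = last∈ ch

  head-vertices : (ch : Chain R P a b) → head (vertices ch) ≡ just a
  head-vertices [ _ ]         = refl
  head-vertices (_ ∷⟨ _ ⟩ _) = refl

  last-vertices : (ch : Chain R P a b) → last (vertices ch) ≡ just b
  last-vertices [ _ ]                        = refl
  last-vertices (_ ∷⟨ _ ⟩ [ _ ])             = refl
  last-vertices (_ ∷⟨ _ ⟩ ch@(_ ∷⟨ _ ⟩ _)) = last-vertices ch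

  all-vertices : (ch : Chain R P a b) → All P (vertices ch)
  all-vertices [ p ]          = p ∷ []
  all-vertices (p ∷⟨ _ ⟩ ch) = p ∷ all-vertices ch

  linked-vertices : (ch : Chain R P a b) → Linked R (vertices ch)
  linked-vertices [ _ ]                         = [-]
  linked-vertices (_ ∷⟨ r ⟩ [ _ ])              = r ∷ [-]
  linked-vertices (_ ∷⟨ r ⟩ ch@(_ ∷⟨ _ ⟩ _)) = r ∷ linked-vertices ch

  lookupᶜ : (ch : Chain R P a b) → v ∈ᴸ vertices ch → P v
  lookupᶜ ch = All.lookup (all-vertices ch)

  fromLinked : (l : List A) → head l ≡ just a → last l ≡ just b → All P l → Linked R l →
               Σ (Chain R P a b) λ ch → vertices ch ≡ l
  fromLinked (_ ∷ [])     refl refl (p ∷ []) _ = [ p ] , refl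
  fromLinked (_ ∷ y ∷ l) refl e (p ∷ ps) (r ∷ rs) with fromLinked (y ∷ l) refl e ps rs
  ... | ch , eq = p ∷⟨ r ⟩ ch , cong (_ ∷_) eq

  mapᶜ : (∀ {v} → P v → Q v) → Chain R P a b → Chain R Q a b
  mapᶜ f [ p ]          = [ f p ]
  mapᶜ f (p ∷⟨ r ⟩ ch) = f p ∷⟨ r ⟩ mapᶜ f ch

  vertices-mapᶜ : (f : ∀ {v} → P v → Q v) (ch : Chain R P a b) → vertices (mapᶜ f ch) ≡ vertices ch
  vertices-mapᶜ f [ _ ]          = refl
  vertices-mapᶜ f (_ ∷⟨ _ ⟩ ch) = cong (_ ∷_) (vertices-mapᶜ f ch)

  ∈-mapᶜ⁻ : (f : ∀ {v} → P v → Q v) (ch : Chain R P a b) → v ∈ᴸ vertices (mapᶜ f ch) → v ∈ᴸ vertices ch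
  ∈-mapᶜ⁻ f ch = subst (_ ∈ᴸ_) (vertices-mapᶜ f ch)

  ∈-mapᶜ⁺ : (f : ∀ {v} → P v → Q v) (ch : Chain R P a b) → v ∈ᴸ vertices ch → v ∈ᴸ vertices (mapᶜ f ch)
  ∈-mapᶜ⁺ f ch = subst (_ ∈ᴸ_) (sym (vertices-mapᶜ f ch))

  mapᶜ-unique : (f : ∀ {v} → P v → Q v) (ch : Chain R P a b) → Unique (vertices ch) → Unique (vertices (mapᶜ f ch))
  mapᶜ-unique f ch = subst Unique (sym (vertices-mapᶜ f ch))

  restrict : (ch : Chain R P a b) → (∀ {v} → v ∈ᴸ vertices ch → Q v) → Chain R Q a b
  restrict [ _ ]          q = [ q (here refl) ]
  restrict (_ ∷⟨ r ⟩ ch) q = q (here refl) ∷⟨ r ⟩ restrict ch (λ m → q (there m))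

  vertices-restrict : (ch : Chain R P a b) (q : ∀ {v} → v ∈ᴸ vertices ch → Q v) → vertices (restrict ch q) ≡ vertices ch
  vertices-restrict [ _ ]          q = refl
  vertices-restrict (_ ∷⟨ _ ⟩ ch) q = cong (_ ∷_) (vertices-restrict ch (λ m → q (there m)))

  _++ᶜ_ : Chain R P a b → Chain R P b c → Chain R P a c
  [ _ ]          ++ᶜ ch' = ch'
  (p ∷⟨ r ⟩ ch) ++ᶜ ch' = p ∷⟨ r ⟩ (ch ++ᶜ ch')

  vertices-++ᶜ : (ch : Chain R P a b) (ch' : Chain R P b c) → vertices (ch ++ᶜ ch') ≡ vertices ch ++ tailVertices ch'
  vertices-++ᶜ [ _ ]          ch' = vertices≡∷tail ch'
  vertices-++ᶜ (_ ∷⟨ _ ⟩ ch) ch' = cong (_ ∷_) (vertices-++ᶜ ch ch')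

  tailVertices-++ᶜ : (ch : Chain R P a b) (ch' : Chain R P b c) → tailVertices (ch ++ᶜ ch') ≡ tailVertices ch ++ tailVertices ch'
  tailVertices-++ᶜ [ _ ]          ch' = refl
  tailVertices-++ᶜ (_ ∷⟨ _ ⟩ ch) ch' = vertices-++ᶜ ch ch'

  ∈-++ᶜ⁻ : (ch : Chain R P a b) (ch' : Chain R P b c) → v ∈ᴸ vertices (ch ++ᶜ ch') → v ∈ᴸ vertices ch ⊎ v ∈ᴸ vertices ch'
  ∈-++ᶜ⁻ ch ch' m with ∈-++⁻ (vertices ch) (subst (_ ∈ᴸ_) (vertices-++ᶜ ch ch') m)
  ... | inj₁ m' = inj₁ m'
  ... | inj₂ m' = inj₂ (tail⊑vertices ch' m')

  _++⟨_⟩_ : ∀ {d} → Chain R P a b → R b c → Chain R P c d → Chain R P a d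
  [ p ]          ++⟨ r ⟩ ch' = p ∷⟨ r ⟩ ch'
  (p ∷⟨ s ⟩ ch) ++⟨ r ⟩ ch' = p ∷⟨ s ⟩ (ch ++⟨ r ⟩ ch')

  vertices-++⟨⟩ : ∀ {d} (ch : Chain R P a b) (r : R b c) (ch' : Chain R P c d) →
                  vertices (ch ++⟨ r ⟩ ch') ≡ vertices ch ++ vertices ch'
  vertices-++⟨⟩ [ _ ]          r ch' = refl
  vertices-++⟨⟩ (_ ∷⟨ _ ⟩ ch) r ch' = cong (_ ∷_) (vertices-++⟨⟩ ch r ch')

  module _ (R-sym : Symmetric R) where

    reverse : Chain R P a b → Chain R P b a
    reverse [ p ]          = [ p ]
    reverse (p ∷⟨ r ⟩ ch) = reverse ch ++⟨ R-sym r ⟩ [ p ]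

    ∈-reverse⁻ : (ch : Chain R P a b) → v ∈ᴸ vertices (reverse ch) → v ∈ᴸ vertices ch
    ∈-reverse⁻ [ _ ]          m = m
    ∈-reverse⁻ (p ∷⟨ r ⟩ ch) m with ∈-++⁻ (vertices (reverse ch)) (subst (_ ∈ᴸ_) (vertices-++⟨⟩ (reverse ch) (R-sym r) [ p ]) m)
    ... | inj₁ m'         = there (∈-reverse⁻ ch m')
    ... | inj₂ (here v≡a) = here v≡a

    ∈-reverse⁺ : (ch : Chain R P a b) → v ∈ᴸ vertices ch → v ∈ᴸ vertices (reverse ch)
    ∈-reverse⁺ [ _ ]          m = m
    ∈-reverse⁺ (p ∷⟨ r ⟩ ch) m = subst (_ ∈ᴸ_) (sym (vertices-++⟨⟩ (reverse ch) (R-sym r) [ p ])) (split m)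
      where
      split : v ∈ᴸ _ ∷ vertices ch → v ∈ᴸ vertices (reverse ch) ++ _ ∷ []
      split (here v≡a) = ∈-++⁺ʳ (vertices (reverse ch)) (here v≡a)
      split (there m') = ∈-++⁺ˡ (∈-reverse⁺ ch m')

    reverse-unique : (ch : Chain R P a b) → Unique (vertices ch) → Unique (vertices (reverse ch))
    reverse-unique [ _ ]          u = u
    reverse-unique (p ∷⟨ r ⟩ ch) (a∉ ∷ u) =
      subst Unique (sym (vertices-++⟨⟩ (reverse ch) (R-sym r) [ p ]))
        (Unique.++⁺ (reverse-unique ch u) ([] ∷ []) λ { (m , here refl) → All.lookup a∉ (∈-reverse⁻ ch m) refl })

  module _ (_≟ᴬ_ : DecidableEquality A) where

    record FirstVisit (ch : Chain R P a b) (v : A) : Set where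
      field
        previous : A
        before   : Chain R P a previous
        fresh    : v ∉ᴸ vertices before
        step     : R previous v
        after    : Chain R P v b
        vertices-split : vertices ch ≡ vertices before ++ vertices after

    splitAtFirst : (ch : Chain R P a b) → v ∈ᴸ vertices ch → a ≡ v ⊎ FirstVisit ch v
    splitAtFirst [ _ ] (here v≡a) = inj₁ (sym v≡a)
    splitAtFirst {a = a} {v = v} (p ∷⟨ r ⟩ ch) m with a ≟ᴬ v | m
    ... | yes a≡v | _         = inj₁ a≡v
    ... | no a≢v  | here v≡a  = ⊥-elim (a≢v (sym v≡a))
    ... | no a≢v  | there m' with splitAtFirst ch m'
    ...   | inj₁ refl = inj₂ record
              { before = [ p ] ; fresh = λ { (here v≡a) → a≢v (sym v≡a) } ; step = r ; after = ch ; vertices-split = refl }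
    ...   | inj₂ fv = inj₂ record
              { before = p ∷⟨ r ⟩ before ; fresh = λ { (here v≡a) → a≢v (sym v≡a) ; (there q) → fresh q }
              ; step = step ; after = after ; vertices-split = cong (a ∷_) vertices-split }
      where open FirstVisit fv

    record Split (ch : Chain R P a b) (v : A) : Set where
      field
        prefix  : Chain R P a v
        suffix  : Chain R P v b
        prefix⊑ : vertices prefix ⊑ vertices ch
        suffix⊑ : vertices suffix ⊑ vertices ch
        shorter : a ≢ v → length (vertices suffix) < length (vertices ch)

    splitAt : (ch : Chain R P a b) → v ∈ᴸ vertices ch → Split ch v
    splitAt ch m with splitAtFirst ch m
    ... | inj₁ refl = record
            { prefix = [ lookupᶜ ch (first∈ ch) ] ; suffix = ch ; prefix⊑ = λ { (here refl) → first∈ ch }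
            ; suffix⊑ = λ q → q ; shorter = λ a≢a → ⊥-elim (a≢a refl) }
    ... | inj₂ fv = record
            { prefix = before ++⟨ step ⟩ [ lookupᶜ after (first∈ after) ] ; suffix = after
            ; prefix⊑ = prefix⊑ ; suffix⊑ = λ q → inCh (∈-++⁺ʳ (vertices before) q) ; shorter = λ _ → shorter }
      where
      open FirstVisit fv
      inCh : vertices before ++ vertices after ⊑ vertices ch
      inCh = subst (λ l → _ ∈ᴸ l) (sym vertices-split)
      prefix⊑ : vertices (before ++⟨ step ⟩ [ _ ]) ⊑ vertices ch
      prefix⊑ q with ∈-++⁻ (vertices before) (subst (_ ∈ᴸ_) (vertices-++⟨⟩ before step [ _ ]) q)
      ... | inj₁ q'        = inCh (∈-++⁺ˡ q')
      ... | inj₂ (here refl) = inCh (∈-++⁺ʳ (vertices before) (first∈ after))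
      shorter : length (vertices after) < length (vertices ch)
      shorter rewrite vertices-split | length-++ (vertices before) {vertices after} | vertices≡∷tail before =
        s≤s (m≤n+m _ _)

    shortcut : (ch : Chain R P a b) → Σ (Chain R P a b) λ ch' → Unique (vertices ch') × vertices ch' ⊑ vertices ch
    shortcut [ p ] = [ p ] , [] ∷ [] , λ q → q
    shortcut {a = a} (p ∷⟨ r ⟩ ch) with shortcut ch
    ... | ch' , u' , ch'⊑ch with _∈ᴸ?_ _≟ᴬ_ a (vertices ch')
    ...   | no a∉ = p ∷⟨ r ⟩ ch' , ¬Any⇒All¬ _ a∉ ∷ u' , λ { (here e) → here e ; (there q) → there (ch'⊑ch q) }
    ...   | yes a∈ with splitAtFirst ch' a∈
    ...     | inj₁ refl = ch' , u' , λ q → there (ch'⊑ch q)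
    ...     | inj₂ fv   = after , Unique-++⁻ʳ (vertices before) (subst Unique vertices-split u') ,
                          λ q → there (ch'⊑ch (subst (_ ∈ᴸ_) (sym vertices-split) (∈-++⁺ʳ (vertices before) q)))
      where open FirstVisit fv

  module _ (R-sym : Symmetric R) (_≟ᴬ_ : DecidableEquality A) where

    toSomeEnd-avoiding : (ch : Chain R P a b) → Unique (vertices ch) → v ∈ᴸ vertices ch → v ≢ z →
                         Chain R (λ u → P u × u ≢ z) v a ⊎ Chain R (λ u → P u × u ≢ z) v b
    toSomeEnd-avoiding {P = P} {v = v} {z = z} ch u v∈ch v≢z with splitAtFirst _≟ᴬ_ ch v∈ch
    ... | inj₁ refl = inj₁ [ lookupᶜ ch v∈ch , v≢z ]
    ... | inj₂ fv with _∈ᴸ?_ _≟ᴬ_ z (vertices (FirstVisit.before fv))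
    ...   | yes z∈before = inj₂ (restrict after λ m → lookupᶜ after m , λ { refl → disjoint (z∈before , m) })
      where
      open FirstVisit fv
      disjoint : Disjoint (vertices before) (vertices after)
      disjoint = Unique-++⇒Disjoint (vertices before) (subst Unique vertices-split u)
    ...   | no z∉before = inj₁ (restrict (reverse R-sym back) λ m → avoid (∈-reverse⁻ R-sym back m))
      where
      open FirstVisit fv
      back : Chain R P _ v
      back = before ++⟨ step ⟩ [ lookupᶜ ch v∈ch ]
      avoid : ∀ {y} → y ∈ᴸ vertices back → P y × y ≢ z
      avoid m with ∈-++⁻ (vertices before) (subst (_ ∈ᴸ_) (vertices-++⟨⟩ before step [ _ ]) m)
      ... | inj₁ m'          = lookupᶜ before m' , λ { refl → z∉before m' }
      ... | inj₂ (here refl) = lookupᶜ ch v∈ch , v≢z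

module _ {n : ℕ} where

  private variable
    S S' : Subset n
    v : Fin n
    l : List (Fin n)

  toSubset : List (Fin n) → Subset n
  toSubset []      = ∅
  toSubset (u ∷ l) = ⁅ u ⁆ ∪ toSubset l

  ∈-toSubset⁺ : v ∈ᴸ l → v ∈ toSubset l
  ∈-toSubset⁺ {l = u ∷ _} (here refl) = x∈p∪q⁺ (inj₁ (x∈⁅x⁆ u))
  ∈-toSubset⁺ {l = _ ∷ _} (there m)   = x∈p∪q⁺ (inj₂ (∈-toSubset⁺ m))

  ∈-toSubset⁻ : v ∈ toSubset l → v ∈ᴸ l
  ∈-toSubset⁻ {l = []}    m = ⊥-elim (∉⊥ m)
  ∈-toSubset⁻ {l = u ∷ l} m with x∈p∪q⁻ ⁅ u ⁆ (toSubset l) m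
  ... | inj₁ m' = here (x∈⁅y⁆⇒x≡y u m')
  ... | inj₂ m' = there (∈-toSubset⁻ m')

  ⊈⇒∃∉ : ¬ S ⊆ S' → DoubleNegation (∃ λ u → u ∈ S × u ∉ S')
  ⊈⇒∃∉ {S' = S'} S⊈S' k = S⊈S' S⊆S'
    where
    S⊆S' : _ ⊆ S'
    S⊆S' {u} u∈S with u ∈? S'
    ... | yes u∈S' = u∈S'
    ... | no u∉S'  = ⊥-elim (k (u , u∈S , u∉S'))

module Walks {n : ℕ} (G : Graph n) where

  open Graph G using (Adj) renaming (sym to Adj-sym)

  private variable
    W : VSet n
    u v w z : Fin n

  toChain : (wk : Walk G W u w) → Σ (Chain Adj W u w) λ ch → vertices ch ≡ Walk.verts wk
  toChain wk = fromLinked (Walk.verts wk) (Walk.start wk) (Walk.end wk) (Walk.inH wk) (Walk.linked wk)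

  fromChain : Chain Adj W u w → Walk G W u w
  fromChain ch = record
    { verts = vertices ch ; start = head-vertices ch ; end = last-vertices ch
    ; inH = all-vertices ch ; linked = linked-vertices ch }

  fromPath : (P : Path G W u w) → Σ (Chain Adj W u w) λ ch → Unique (vertices ch) × pverts G P ⊑ vertices ch
  fromPath P =
    let (ch , ch≡P) = toChain (Path.walk P)
    in ch , subst Unique (sym ch≡P) (Path.distinct P) , subst (_ ∈ᴸ_) (sym ch≡P)

  hub⇒¬cut : ∀ h → (∀ {v} → W v → v ≢ z → DoubleNegation (Chain Adj (W ∖₁ z) v h)) → ¬ IsCutVertex G W z
  hub⇒¬cut h reach (_ , u , w , Wu , Ww , u≢z , w≢z , _ , no-walk) =
    reach Wu u≢z λ u→h → reach Ww w≢z λ w→h → no-walk (fromChain (u→h ++ᶜ reverse Adj-sym w→h))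

  module _ {W : VSet n} {x c c' p p'} (P : Chain Adj W c p) (X : Chain Adj W c c') (P' : Chain Adj W c' p')
      (P-unique : Unique (vertices P)) (X-unique : Unique (vertices X)) (P'-unique : Unique (vertices P'))
      (P#P' : Disjoint (vertices P) (vertices P'))
      (P∩X≡c : ∀ {y} → y ∈ᴸ vertices P → y ∈ᴸ vertices X → y ≡ c)
      (X∩P'≡c' : ∀ {y} → y ∈ᴸ vertices X → y ∈ᴸ vertices P' → y ≡ c')
      (c≢c' : c ≢ c') (p~x : Adj p x) (p'~x : Adj p' x) (W∌x : ∀ {y} → W y → y ≢ x) where

    private
      A : Chain Adj W p p'
      A = reverse Adj-sym P ++ᶜ (X ++ᶜ P')

      vertices-A : vertices A ≡ vertices (reverse Adj-sym P) ++ (tailVertices X ++ tailVertices P')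
      vertices-A = trans (vertices-++ᶜ (reverse Adj-sym P) (X ++ᶜ P')) (cong (vertices (reverse Adj-sym P) ++_) (tailVertices-++ᶜ X P'))

      C : Chain Adj (λ y → W y ⊎ y ≡ x) x p'
      C = inj₂ refl ∷⟨ Adj-sym p~x ⟩ mapᶜ inj₁ A

      vertices-C : vertices C ≡ x ∷ vertices (reverse Adj-sym P) ++ (tailVertices X ++ tailVertices P')
      vertices-C = cong (x ∷_) (trans (vertices-mapᶜ inj₁ A) vertices-A)

      tailX#tailP' : Disjoint (tailVertices X) (tailVertices P')
      tailX#tailP' (y∈X , y∈P') with X∩P'≡c' (tail⊑vertices X y∈X) (tail⊑vertices P' y∈P')
      ... | refl = first∉tail P' P'-unique y∈P'

      P#rest : Disjoint (vertices (reverse Adj-sym P)) (tailVertices X ++ tailVertices P')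
      P#rest (y∈P , y∈rest) with ∈-++⁻ (tailVertices X) y∈rest
      ... | inj₂ y∈P' = P#P' (∈-reverse⁻ Adj-sym P y∈P , tail⊑vertices P' y∈P')
      ... | inj₁ y∈X with P∩X≡c (∈-reverse⁻ Adj-sym P y∈P) (tail⊑vertices X y∈X)
      ...   | refl = first∉tail X X-unique y∈X

      A-unique : Unique (vertices A)
      A-unique = subst Unique (sym vertices-A)
        (Unique.++⁺ (reverse-unique Adj-sym P P-unique)
                    (Unique.++⁺ (tail-unique X X-unique) (tail-unique P' P'-unique) tailX#tailP') P#rest)

      c'∈rest : c' ∈ᴸ tailVertices X ++ tailVertices P'
      c'∈rest = ∈-++⁺ˡ (last∈tail X c≢c')

      ∈C : ∀ {y} → y ∈ᴸ vertices (reverse Adj-sym P) ++ (tailVertices X ++ tailVertices P') → y ∈ᴸ vertices C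
      ∈C {y} m = subst (y ∈ᴸ_) (sym vertices-C) (there m)

      P'⊑C : vertices P' ⊑ vertices C
      P'⊑C m with subst (_ ∈ᴸ_) (vertices≡∷tail P') m
      ... | here refl = ∈C (∈-++⁺ʳ (vertices (reverse Adj-sym P)) c'∈rest)
      ... | there m'  = ∈C (∈-++⁺ʳ (vertices (reverse Adj-sym P)) (∈-++⁺ʳ (tailVertices X) m'))

    close-cycle : ∃ λ cs → IsCycle G (λ y → W y ⊎ y ≡ x) cs × vertices P ⊑ cs × vertices P' ⊑ cs
    close-cycle =
      vertices C ,
      ( subst (λ cs → 3 ≤ length cs) (sym vertices-C) (s≤s (∈∧∈⇒2≤length-++ (first∈ (reverse Adj-sym P)) c'∈rest))
      , subst Unique (sym (cong (x ∷_) (vertices-mapᶜ inj₁ A)))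
              (All.tabulate (λ m → W∌x (lookupᶜ A m) ∘ sym) ∷ A-unique)
      , all-vertices C , linked-vertices C , p' , x , last-vertices C , refl , p'~x ) ,
      (∈C ∘ ∈-++⁺ˡ ∘ ∈-reverse⁺ Adj-sym P) , P'⊑C

module Blocks {n : ℕ} (G : Graph n) (H : VSet n) where

  open Graph G using (Adj) renaming (sym to Adj-sym)
  open Walks G

  private variable
    S S' : Subset n
    u v w z : Fin n

  block⊆ : IsBlock G H S → v ∈ S → H v
  block⊆ (_ , (S⊆H , _ , _) , _) = S⊆H _

  blockChain : IsBlock G H S → u ∈ S → w ∈ S → Chain Adj ⟦ S ⟧ u w
  blockChain (_ , (_ , connected , _) , _) u∈S w∈S = proj₁ (toChain (connected _ _ u∈S w∈S))

  blockChain-avoiding : IsBlock G H S → u ∈ S → w ∈ S → u ≢ z → w ≢ z →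
                        DoubleNegation (Chain Adj (⟦ S ⟧ ∖₁ z) u w)
  blockChain-avoiding {S} {z = z} BS@(_ , (_ , connected , no-cut) , _) u∈S w∈S u≢z w≢z k with z ∈? S
  ... | yes z∈S = no-cut z (z∈S , _ , _ , u∈S , w∈S , u≢z , w≢z , connected _ _ u∈S w∈S , λ wk → k (proj₁ (toChain wk)))
  ... | no z∉S  = k (mapᶜ (λ v∈S → v∈S , λ { refl → z∉S v∈S }) (blockChain BS u∈S w∈S))

  block-⊈ : IsBlock G H S → IsBlock G H S' → S ≢ S' → ¬ S ⊆ S'
  block-⊈ {S' = S'} BS (_ , S'-conn , _) S≢S' S⊆S' = S≢S' (⊆-antisym S⊆S' (proj₂ (proj₂ BS) S' S⊆S' S'-conn))

  -- Two distinct blocks through c, joined by a path Q avoiding c, would make S ∪ S' ∪ Q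
  -- a connected set without cut vertex, contradicting the maximality of S.
  module MergedBlocks {S S' c a b} (BS : IsBlock G H S) (BS' : IsBlock G H S')
      (c∈S : c ∈ S) (c∈S' : c ∈ S') (a∈S : a ∈ S) (a≢c : a ≢ c) (b∈S' : b ∈ S') (b≢c : b ≢ c)
      (Q : Chain Adj (H ∖₁ c) a b) (Q-unique : Unique (vertices Q)) where

    K : Subset n
    K = S ∪ (S' ∪ toSubset (vertices Q))

    K-cases : v ∈ K → v ∈ S ⊎ v ∈ S' ⊎ v ∈ᴸ vertices Q
    K-cases v∈K with x∈p∪q⁻ S _ v∈K
    ... | inj₁ v∈S = inj₁ v∈S
    ... | inj₂ v∈K' with x∈p∪q⁻ S' _ v∈K'
    ...   | inj₁ v∈S' = inj₂ (inj₁ v∈S')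
    ...   | inj₂ v∈Q  = inj₂ (inj₂ (∈-toSubset⁻ v∈Q))

    S⊆K : S ⊆ K
    S⊆K m = x∈p∪q⁺ (inj₁ m)

    S'⊆K : S' ⊆ K
    S'⊆K m = x∈p∪q⁺ (inj₂ (x∈p∪q⁺ (inj₁ m)))

    Q⊆K : v ∈ᴸ vertices Q → v ∈ K
    Q⊆K m = x∈p∪q⁺ (inj₂ (x∈p∪q⁺ (inj₂ (∈-toSubset⁺ m))))

    K⊆H : v ∈ K → H v
    K⊆H v∈K with K-cases v∈K
    ... | inj₁ v∈S        = block⊆ BS v∈S
    ... | inj₂ (inj₁ v∈S') = block⊆ BS' v∈S'
    ... | inj₂ (inj₂ v∈Q)  = proj₁ (lookupᶜ Q v∈Q)

    into-K : ∀ {T : VSet n} → (∀ {v} → T v → v ∈ K) → Chain Adj (T ∖₁ z) u w → Chain Adj (⟦ K ⟧ ∖₁ z) u w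
    into-K T⊆K = mapᶜ λ { (Tv , v≢z) → T⊆K Tv , v≢z }

    QK : Chain Adj (⟦ K ⟧ ∖₁ c) a b
    QK = restrict Q λ m → Q⊆K m , proj₂ (lookupᶜ Q m)

    ∈QK : v ∈ᴸ vertices Q → v ∈ᴸ vertices QK
    ∈QK = subst (_ ∈ᴸ_) (sym (vertices-restrict Q _))

    Q-from : v ∈ᴸ vertices Q → Chain Adj (⟦ K ⟧ ∖₁ c) v a
    Q-from v∈Q = reverse Adj-sym (Split.prefix (splitAt _≟_ QK (∈QK v∈Q)))

    to-a-avoiding-c : v ∈ K → v ≢ c → DoubleNegation (Chain Adj (⟦ K ⟧ ∖₁ c) v a)
    to-a-avoiding-c v∈K v≢c k with K-cases v∈K
    ... | inj₁ v∈S         = blockChain-avoiding BS v∈S a∈S v≢c a≢c (k ∘ into-K S⊆K)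
    ... | inj₂ (inj₁ v∈S') = blockChain-avoiding BS' v∈S' b∈S' v≢c b≢c λ v→b → k (into-K S'⊆K v→b ++ᶜ Q-from (last∈ Q))
    ... | inj₂ (inj₂ v∈Q)  = k (Q-from v∈Q)

    forget-c : Chain Adj (λ u → (⟦ K ⟧ ∖₁ c) u × u ≢ z) u w → Chain Adj (⟦ K ⟧ ∖₁ z) u w
    forget-c = mapᶜ λ { ((u∈K , _) , u≢z) → u∈K , u≢z }

    end≢z : ∀ {T : VSet n} → Chain Adj (λ u → T u × u ≢ z) u w → w ≢ z
    end≢z ch = proj₂ (lookupᶜ ch (last∈ ch))

    to-c-avoiding : z ≢ c → v ∈ K → v ≢ z → DoubleNegation (Chain Adj (⟦ K ⟧ ∖₁ z) v c)
    to-c-avoiding z≢c v∈K v≢z k with K-cases v∈K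
    ... | inj₁ v∈S         = blockChain-avoiding BS v∈S c∈S v≢z (z≢c ∘ sym) (k ∘ into-K S⊆K)
    ... | inj₂ (inj₁ v∈S') = blockChain-avoiding BS' v∈S' c∈S' v≢z (z≢c ∘ sym) (k ∘ into-K S'⊆K)
    ... | inj₂ (inj₂ v∈Q) with toSomeEnd-avoiding Adj-sym _≟_ QK (subst Unique (sym (vertices-restrict Q _)) Q-unique) (∈QK v∈Q) v≢z
    ...   | inj₁ v→a = blockChain-avoiding BS a∈S c∈S (end≢z v→a) (z≢c ∘ sym) λ a→c → k (forget-c v→a ++ᶜ into-K S⊆K a→c)
    ...   | inj₂ v→b = blockChain-avoiding BS' b∈S' c∈S' (end≢z v→b) (z≢c ∘ sym) λ b→c → k (forget-c v→b ++ᶜ into-K S'⊆K b→c)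

    K-connNoCut : ConnNoCut G H K
    K-connNoCut = (λ _ → K⊆H) , connected , no-cut
      where
      to-c : v ∈ K → Chain Adj ⟦ K ⟧ v c
      to-c v∈K with K-cases v∈K
      ... | inj₁ v∈S         = mapᶜ S⊆K (blockChain BS v∈S c∈S)
      ... | inj₂ (inj₁ v∈S') = mapᶜ S'⊆K (blockChain BS' v∈S' c∈S')
      ... | inj₂ (inj₂ v∈Q)  = mapᶜ proj₁ (Q-from v∈Q) ++ᶜ mapᶜ S⊆K (blockChain BS a∈S c∈S)
      connected : ∀ u w → u ∈ K → w ∈ K → Walk G ⟦ K ⟧ u w
      connected _ _ u∈K w∈K = fromChain (to-c u∈K ++ᶜ reverse Adj-sym (to-c w∈K))
      no-cut : ∀ z → ¬ IsCutVertex G ⟦ K ⟧ z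
      no-cut z with z ≟ c
      ... | yes refl = hub⇒¬cut a to-a-avoiding-c
      ... | no z≢c   = hub⇒¬cut c (to-c-avoiding z≢c)

    S'⊆S : S' ⊆ S
    S'⊆S = proj₂ (proj₂ BS) K S⊆K K-connNoCut ∘ S'⊆K

  shared-vertex-separates : ∀ {c a b} → IsBlock G H S → IsBlock G H S' → S ≢ S' → c ∈ S → c ∈ S' →
                            a ∈ S → a ≢ c → b ∈ S' → b ≢ c → ¬ Chain Adj (H ∖₁ c) a b
  shared-vertex-separates BS BS' S≢S' c∈S c∈S' a∈S a≢c b∈S' b≢c ch =
    let (path , path-unique , _) = shortcut _≟_ ch
    in block-⊈ BS' BS (S≢S' ∘ sym) (MergedBlocks.S'⊆S BS BS' c∈S c∈S' a∈S a≢c b∈S' b≢c path path-unique)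

  shared-vertex-is-cut : IsBlock G H S → IsBlock G H S' → S ≢ S' → v ∈ S → v ∈ S' →
                         DoubleNegation (IsCutVertex G H v)
  shared-vertex-is-cut BS BS' S≢S' v∈S v∈S' k =
    ⊈⇒∃∉ (block-⊈ BS BS' S≢S') λ { (a , a∈S , a∉S') →
    ⊈⇒∃∉ (block-⊈ BS' BS (S≢S' ∘ sym)) λ { (b , b∈S' , b∉S) →
    let a≢v : _ ≢ _
        a≢v = λ { refl → a∉S' v∈S' }
        b≢v : _ ≢ _
        b≢v = λ { refl → b∉S v∈S }
    in k ( block⊆ BS v∈S , a , b , block⊆ BS a∈S , block⊆ BS' b∈S' , a≢v , b≢v
         , fromChain (mapᶜ (block⊆ BS) (blockChain BS a∈S v∈S) ++ᶜ mapᶜ (block⊆ BS') (blockChain BS' v∈S' b∈S'))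
         , λ wk → shared-vertex-separates BS BS' S≢S' v∈S v∈S' a∈S a≢v b∈S' b≢v (proj₁ (toChain wk))) } }

module BlockCutForest {n : ℕ} (G : Graph n) (H : VSet n) (R : Rooting G H) where

  open Graph G using (Adj)
  open Rooting R
  open Walks G
  open Blocks G H

  private variable
    d e f : Node n
    S S₀ S' : Subset n
    v y : Fin n

  _≟ᴺ_ : DecidableEquality (Node n)
  cut u ≟ᴺ cut w with u ≟ w
  ... | yes refl = yes refl
  ... | no u≢w   = no λ { refl → u≢w refl }
  blk S ≟ᴺ blk S' with ≡-dec _≟ᴮ_ S S'
  ... | yes refl = yes refl
  ... | no S≢S'  = no λ { refl → S≢S' refl }
  cut _ ≟ᴺ blk _ = no λ ()
  blk _ ≟ᴺ cut _ = no λ ()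

  BCChain : Node n → Node n → Set
  BCChain = Chain (BCAdj G) (ValidNode G H)

  infix 4 _⊴_
  _⊴_ : Node n → Node n → Set
  _⊴_ = InSubtree G H R

  fromBCWalk : (wk : BCWalk G H d e) → Σ (BCChain d e) λ ch → vertices ch ≡ BCWalk.nodes wk
  fromBCWalk wk = fromLinked (BCWalk.nodes wk) (BCWalk.start wk) (BCWalk.end wk) (BCWalk.valid wk) (BCWalk.linked wk)

  toBCWalk : BCChain d e → BCWalk G H d e
  toBCWalk ch = record
    { nodes = vertices ch ; start = head-vertices ch ; end = last-vertices ch
    ; valid = all-vertices ch ; linked = linked-vertices ch }

  AllRootChainsVia : Node n → Node n → Set
  AllRootChainsVia d e = ∀ S → Root S → (ch : BCChain d (blk S)) → e ∈ᴸ vertices ch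

  ⊴-intro : ValidNode G H d → ValidNode G H e → AllRootChainsVia d e → d ⊴ e
  ⊴-intro vd ve via = vd , ve , λ S r wk →
    let (ch , ch≡wk) = fromBCWalk wk
    in subst (_ ∈ᴸ_) ch≡wk (via S r ch)

  ⊴-elim : d ⊴ e → AllRootChainsVia d e
  ⊴-elim (_ , _ , via) S r ch = via S r (toBCWalk ch)

  lower-valid : d ⊴ e → ValidNode G H d
  lower-valid = proj₁

  upper-valid : d ⊴ e → ValidNode G H e
  upper-valid = proj₁ ∘ proj₂

  rootChain : ValidNode G H d → Σ (Subset n) λ S → Root S × BCChain d (blk S)
  rootChain vd with reach _ vd
  ... | S , r , wk = S , r , proj₁ (fromBCWalk wk)

  ⋬⇒avoiding-rootChain : ValidNode G H d → ValidNode G H e → ¬ d ⊴ e →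
                          DoubleNegation (∃ λ S → Root S × Σ (BCChain d (blk S)) λ ch → e ∉ᴸ vertices ch)
  ⋬⇒avoiding-rootChain {e = e} vd ve d⋬e k = d⋬e (⊴-intro vd ve via)
    where
    via : AllRootChainsVia _ e
    via S r ch with _∈ᴸ?_ _≟ᴺ_ e (vertices ch)
    ... | yes e∈ch = e∈ch
    ... | no e∉ch  = ⊥-elim (k (S , r , ch , e∉ch))

  ⊴-refl : ValidNode G H d → d ⊴ d
  ⊴-refl vd = ⊴-intro vd vd λ _ _ ch → first∈ ch

  ⊴-trans : d ⊴ e → e ⊴ f → d ⊴ f
  ⊴-trans d⊴e e⊴f = ⊴-intro (lower-valid d⊴e) (upper-valid e⊴f) λ S r ch →
    let split = splitAt _≟ᴺ_ ch (⊴-elim d⊴e S r ch)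
    in Split.suffix⊑ split (⊴-elim e⊴f S r (Split.suffix split))

  ⊴-antisym : d ⊴ e → e ⊴ d → d ≡ e
  ⊴-antisym {d} {e} d⊴e e⊴d with d ≟ᴺ e
  ... | yes d≡e = d≡e
  ... | no d≢e with rootChain (lower-valid d⊴e)
  ...   | S , r , ch = ⊥-elim (descent (suc (length (vertices ch))) ch ≤-refl)
    where
    -- each round trip d → e → d along a root chain strictly shortens it
    descent : ∀ k (ch : BCChain d (blk S)) → length (vertices ch) < k → ⊥
    descent (suc k) ch len<k =
      let split₁ = splitAt _≟ᴺ_ ch (⊴-elim d⊴e S r ch)
          split₂ = splitAt _≟ᴺ_ (Split.suffix split₁) (⊴-elim e⊴d S r (Split.suffix split₁))
      in descent k (Split.suffix split₂)
           (<-≤-trans (Split.shorter split₂ (d≢e ∘ sym)) (≤-trans (<⇒≤ (Split.shorter split₁ d≢e)) (≤-pred len<k)))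

  ⊴-parent : BCAdj G d e → d ⊴ e → d ⊴ f → d ≢ f → e ⊴ f
  ⊴-parent {e = e} {f = f} d~e d⊴e d⊴f d≢f = ⊴-intro (upper-valid d⊴e) (upper-valid d⊴f) via
    where
    via : AllRootChainsVia e f
    via S r ch with ⊴-elim d⊴f S r (lower-valid d⊴e ∷⟨ d~e ⟩ ch)
    ... | here f≡d = ⊥-elim (d≢f (sym f≡d))
    ... | there m  = m

  ⊴-comparable : d ⊴ e → d ⊴ f → ¬ e ⊴ f → ¬ f ⊴ e → ⊥
  ⊴-comparable {f = f} d⊴e d⊴f e⋬f f⋬e with rootChain (lower-valid d⊴e)
  ... | S , r , ch with splitAtFirst _≟ᴺ_ ch (⊴-elim d⊴e S r ch)
  ...   | inj₁ refl = e⋬f d⊴f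
  ...   | inj₂ fv =
    ⋬⇒avoiding-rootChain (upper-valid d⊴e) (upper-valid d⊴f) e⋬f λ { (S₁ , r₁ , e→root , f∉) →
      f-in-before (∈-++⁻ (vertices before) (subst (f ∈ᴸ_) (vertices-++⟨⟩ before step e→root)
                     (⊴-elim d⊴f S₁ r₁ (before ++⟨ step ⟩ e→root)))) f∉ }
    where
    open FirstVisit fv
    f-in-before : ∀ {l} → f ∈ᴸ vertices before ⊎ f ∈ᴸ l → f ∉ᴸ l → ⊥
    f-in-before (inj₂ f∈l)      f∉l = f∉l f∈l
    f-in-before (inj₁ f∈before) _   =
      ⋬⇒avoiding-rootChain (upper-valid d⊴f) (upper-valid d⊴e) f⋬e λ { (S₂ , r₂ , f→root , e∉) →
        [ fresh ∘ Split.prefix⊑ split , e∉ ]′ (∈-++ᶜ⁻ (Split.prefix split) f→root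
          (⊴-elim d⊴e S₂ r₂ (Split.prefix split ++ᶜ f→root))) }
      where
      split : Split _≟ᴺ_ before f
      split = splitAt _≟ᴺ_ before f∈before

  ⊴-across-cut : blk S ⊴ cut v → ValidNode G H (blk S') → y ∈ S' → y ∈ S → y ≢ v → IsCutVertex G H y →
                 blk S' ⊴ cut v
  ⊴-across-cut {v = v} {y = y} S⊴v vS' y∈S' y∈S y≢v y-cut = ⊴-intro vS' (upper-valid S⊴v) via
    where
    via : AllRootChainsVia _ (cut v)
    via S₀ r ch with ⊴-elim S⊴v S₀ r (_∷⟨_⟩_ {b = cut y} (lower-valid S⊴v) y∈S (_∷⟨_⟩_ {b = blk _} y-cut y∈S' ch))
    ... | here ()
    ... | there (here refl) = ⊥-elim (y≢v refl)
    ... | there (there m)   = m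

  lift-avoiding : ∀ {c a} (ch : BCChain (blk S₀) (blk S')) → cut c ∉ᴸ vertices ch → a ∈ S₀ → a ≢ c →
                  DoubleNegation (∃ λ b → b ∈ S' × b ≢ c × Chain Adj (H ∖₁ c) a b)
  lift-avoiding {a = a} [ BS₀ ] _ a∈S₀ a≢c k = k (a , a∈S₀ , a≢c , [ block⊆ BS₀ a∈S₀ , a≢c ])
  lift-avoiding (_∷⟨_⟩_ {b = blk _} _ () _)
  lift-avoiding {c = c} (_∷⟨_⟩_ {b = cut _} BS₀ a₁∈S₀ (_∷⟨_⟩_ {b = blk _} _ a₁∈S₁ rest)) c∉ a∈S₀ a≢c k =
    blockChain-avoiding BS₀ a∈S₀ a₁∈S₀ a≢c a₁≢c λ a→a₁ →
      lift-avoiding rest (c∉ ∘ there ∘ there) a₁∈S₁ a₁≢c λ { (b , b∈S' , b≢c , a₁→b) →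
        k (b , b∈S' , b≢c , mapᶜ (λ { (v∈S₀ , v≢c) → block⊆ BS₀ v∈S₀ , v≢c }) a→a₁ ++ᶜ a₁→b) }
    where
    a₁≢c : _ ≢ c
    a₁≢c refl = c∉ (there (here refl))

  other-block-below : ∀ {c} → IsBlock G H S → IsBlock G H S' → S ≢ S' → c ∈ S → c ∈ S' →
                      cut c ⊴ blk S' → DoubleNegation (blk S ⊴ cut c)
  other-block-below {S} {S'} {c} BS BS' S≢S' c∈S c∈S' c⊴S' k = k (⊴-intro BS (lower-valid c⊴S') via)
    where
    via : AllRootChainsVia (blk S) (cut c)
    via S₀ r ch with _∈ᴸ?_ _≟ᴺ_ (cut c) (vertices ch)
    ... | yes c∈ch = c∈ch
    ... | no c∉ch with ⊴-elim c⊴S' S₀ r (_∷⟨_⟩_ {b = blk S} (lower-valid c⊴S') c∈S ch)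
    ...   | here ()
    ...   | there S'∈ch = ⊥-elim (⊈⇒∃∉ (block-⊈ BS BS' S≢S') λ { (a , a∈S , a∉S') →
              let a≢c : a ≢ c
                  a≢c = λ { refl → a∉S' c∈S' }
              in lift-avoiding (Split.prefix split) (c∉ch ∘ Split.prefix⊑ split) a∈S a≢c λ { (b , b∈S' , b≢c , a→b) →
                   shared-vertex-separates BS BS' S≢S' c∈S c∈S' a∈S a≢c b∈S' b≢c a→b } })
      where
      split : Split _≟ᴺ_ ch (blk S')
      split = splitAt _≟ᴺ_ ch S'∈ch

module Grandchildren {n : ℕ} (G : Graph n) (x : Fin n) (R : Rooting G (λ v → v ≢ x)) (t : Fin n) where

  H : VSet n
  H v = v ≢ x

  open Graph G using (Adj) renaming (sym to Adj-sym)
  open Walks G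
  open Blocks G H
  open BlockCutForest G H R

  private variable
    c c' y : Fin n
    S S₁ S₂ : Subset n
    B : Node n

  V[_] : Fin n → VSet n
  V[ c ] = VG G H R (cut c)

  record GrandchildVia (c : Fin n) (S₁ : Subset n) : Set where
    field
      c⊴S₁ : cut c ⊴ blk S₁
      c∈S₁ : c ∈ S₁
      S₁⊴t : blk S₁ ⊴ cut t
      t∈S₁ : t ∈ S₁

  grandchild-via : Grandchild G H R (cut c) (cut t) → ∃ (GrandchildVia c)
  grandchild-via (blk S₁ , (S₁⊴t , t∈S₁) , (c⊴S₁ , c∈S₁)) = S₁ , record { c⊴S₁ = c⊴S₁ ; c∈S₁ = c∈S₁ ; S₁⊴t = S₁⊴t ; t∈S₁ = t∈S₁ }
  grandchild-via (cut _ , (_ , ()) , _)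

  child-block⋬grandchild : blk S ⊴ cut t → t ∈ S → GrandchildVia c S₁ → ¬ blk S ⊴ cut c
  child-block⋬grandchild S⊴t t∈S gc S⊴c with ⊴-antisym (⊴-trans c⊴S₁ S₁⊴t) (⊴-parent t∈S S⊴t S⊴c λ ())
    where open GrandchildVia gc
  ... | refl with ⊴-antisym (GrandchildVia.c⊴S₁ gc) (GrandchildVia.S₁⊴t gc)
  ...   | ()

  grandchild-subtrees-disjoint : c ≢ c' → GrandchildVia c S₁ → GrandchildVia c' S₂ →
                                 blk S ⊴ cut c → blk S ⊴ cut c' → ⊥
  grandchild-subtrees-disjoint c≢c' gc gc' S⊴c S⊴c' = ⊴-comparable S⊴c S⊴c'
    (λ c⊴c' → child-block⋬grandchild (S₁⊴t gc) (t∈S₁ gc) gc' (⊴-parent (c∈S₁ gc) (c⊴S₁ gc) c⊴c' λ { refl → c≢c' refl }))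
    (λ c'⊴c → child-block⋬grandchild (S₁⊴t gc') (t∈S₁ gc') gc (⊴-parent (c∈S₁ gc') (c⊴S₁ gc') c'⊴c λ { refl → c≢c' refl }))
    where open GrandchildVia

  grandchild-vertices-disjoint : c ≢ c' → GrandchildVia c S₁ → GrandchildVia c' S₂ → V[ c ] y → V[ c' ] y → ⊥
  grandchild-vertices-disjoint {y = y} c≢c' gc gc' (S , S⊴c , y∈S) (S' , S'⊴c' , y∈S') with ≡-dec _≟ᴮ_ S S'
  ... | yes refl = grandchild-subtrees-disjoint c≢c' gc gc' S⊴c S'⊴c'
  ... | no S≢S'  = shared-vertex-is-cut (lower-valid S⊴c) (lower-valid S'⊴c') S≢S' y∈S y∈S' y-cut
    where
    -- if y were a cut vertex, the blocks S and S' meeting at y would put one of them into both subtrees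
    y-cut : ¬ IsCutVertex G H y
    y-cut y-is-cut with y ≟ _
    ... | no y≢c    = grandchild-subtrees-disjoint c≢c' gc gc' (⊴-across-cut S⊴c (lower-valid S'⊴c') y∈S' y∈S y≢c y-is-cut) S'⊴c'
    ... | yes refl  = grandchild-subtrees-disjoint c≢c' gc gc' S⊴c (⊴-across-cut S'⊴c' (lower-valid S⊴c) y∈S y∈S' c≢c' y-is-cut)

  child-block∩V≡ : GrandchildVia c S₁ → blk S ⊴ cut t → t ∈ S → y ∈ S → V[ c ] y → y ≡ c
  child-block∩V≡ {c = c} {S = S} {y = y} gc S⊴t t∈S y∈S (S' , S'⊴c , y∈S') with y ≟ c
  ... | yes y≡c = y≡c
  ... | no y≢c with ≡-dec _≟ᴮ_ S S'
  ...   | yes refl = ⊥-elim (child-block⋬grandchild S⊴t t∈S gc S'⊴c)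
  ...   | no S≢S'  = ⊥-elim (shared-vertex-is-cut (lower-valid S⊴t) (lower-valid S'⊴c) S≢S' y∈S y∈S' λ y-cut →
                       child-block⋬grandchild S⊴t t∈S gc (⊴-across-cut S'⊴c (lower-valid S⊴t) y∈S y∈S' y≢c y-cut))

  parent-block⊴ : c ≢ c' → GrandchildVia c S₁ → GrandchildVia c' S₂ →
                  VG G H R B c → VG G H R B c' → V[ c' ] c' → DoubleNegation (blk S₁ ⊴ B)
  parent-block⊴ {S₁ = S₁} {B = B} c≢c' gc gc' (S , S⊴B , c∈S) (S' , S'⊴B , c'∈S') c'∈V k with ≡-dec _≟ᴮ_ S S₁
  ... | yes refl = k S⊴B
  ... | no S≢S₁  = other-block-below (lower-valid S⊴B) (upper-valid c⊴S₁) S≢S₁ c∈S c∈S₁ c⊴S₁ λ S⊴c →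
                     ⊴-comparable S⊴c S⊴B c⋬B B⋬c
    where
    open GrandchildVia gc
    B⋬c : ¬ B ⊴ cut _
    B⋬c B⊴c = grandchild-vertices-disjoint c≢c' gc gc' (S' , ⊴-trans S'⊴B B⊴c , c'∈S') c'∈V
    c⋬B : ¬ cut _ ⊴ B
    c⋬B c⊴B = k (⊴-parent c∈S₁ c⊴S₁ c⊴B λ { refl → B⋬c (⊴-refl (lower-valid c⊴S₁)) })

  module _ {S₁ S₂ B c c' p p'} (c≢c' : c ≢ c') (gc : GrandchildVia c S₁) (gc' : GrandchildVia c' S₂)
      (S₁⊴B : blk S₁ ⊴ B) (S₂⊴B : blk S₂ ⊴ B) (p~x : Adj p x) (p'~x : Adj p' x)
      (P : Chain Adj V[ c ] c p) (P-unique : Unique (vertices P))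
      (P' : Chain Adj V[ c' ] c' p') (P'-unique : Unique (vertices P')) where

    private
      open GrandchildVia

      W : VSet n
      W = VG G H R B

      V⊆W : ∀ {d Sd} → GrandchildVia d Sd → blk Sd ⊴ B → V[ d ] y → W y
      V⊆W gd Sd⊴B (S , S⊴d , y∈S) = S , ⊴-trans S⊴d (⊴-trans (c⊴S₁ gd) Sd⊴B) , y∈S

      S₁∪S₂⊆W : y ∈ S₁ ⊎ y ∈ S₂ → W y
      S₁∪S₂⊆W = [ (λ y∈S₁ → _ , S₁⊴B , y∈S₁) , (λ y∈S₂ → _ , S₂⊴B , y∈S₂) ]′

      W∌x : W y → y ≢ x
      W∌x (_ , S⊴B , y∈S) = block⊆ (lower-valid S⊴B) y∈S

      X-walk : Chain Adj (λ y → y ∈ S₁ ⊎ y ∈ S₂) c c'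
      X-walk = mapᶜ inj₁ (blockChain (upper-valid (c⊴S₁ gc)) (c∈S₁ gc) (t∈S₁ gc))
            ++ᶜ mapᶜ inj₂ (blockChain (upper-valid (c⊴S₁ gc')) (t∈S₁ gc') (c∈S₁ gc'))

      X : Chain Adj (λ y → y ∈ S₁ ⊎ y ∈ S₂) c c'
      X = proj₁ (shortcut _≟_ X-walk)

      X-unique : Unique (vertices X)
      X-unique = proj₁ (proj₂ (shortcut _≟_ X-walk))

      X∩V≡ : ∀ {d Sd} → GrandchildVia d Sd → y ∈ S₁ ⊎ y ∈ S₂ → V[ d ] y → y ≡ d
      X∩V≡ gd (inj₁ y∈S₁) = child-block∩V≡ gd (S₁⊴t gc) (t∈S₁ gc) y∈S₁
      X∩V≡ gd (inj₂ y∈S₂) = child-block∩V≡ gd (S₁⊴t gc') (t∈S₁ gc') y∈S₂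

      fP : V[ c ] y → W y
      fP = V⊆W gc S₁⊴B

      fP' : V[ c' ] y → W y
      fP' = V⊆W gc' S₂⊴B

    grandchildren-cycle : ∃ λ cs → IsCycle G (λ y → W y ⊎ y ≡ x) cs × vertices P ⊑ cs × vertices P' ⊑ cs
    grandchildren-cycle =
      let (cs , cycle , P⊑cs , P'⊑cs) = close-cycle (mapᶜ fP P) (mapᶜ S₁∪S₂⊆W X) (mapᶜ fP' P')
            (mapᶜ-unique fP P P-unique) (mapᶜ-unique S₁∪S₂⊆W X X-unique) (mapᶜ-unique fP' P' P'-unique)
            (λ (m , m') → grandchild-vertices-disjoint c≢c' gc gc' (lookupᶜ P (∈-mapᶜ⁻ fP P m)) (lookupᶜ P' (∈-mapᶜ⁻ fP' P' m')))
            (λ m m' → X∩V≡ gc (lookupᶜ X (∈-mapᶜ⁻ S₁∪S₂⊆W X m')) (lookupᶜ P (∈-mapᶜ⁻ fP P m)))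
            (λ m m' → X∩V≡ gc' (lookupᶜ X (∈-mapᶜ⁻ S₁∪S₂⊆W X m)) (lookupᶜ P' (∈-mapᶜ⁻ fP' P' m')))
            c≢c' p~x p'~x W∌x
      in cs , cycle , P⊑cs ∘ ∈-mapᶜ⁺ fP P , P'⊑cs ∘ ∈-mapᶜ⁺ fP' P'

  two-grandchildren⇒T-cycle : ∀ {T B c c'} → c ≢ c' →
    VG G H R B c → InC≥1 G H R T x t c → VG G H R B c' → InC≥1 G H R T x t c' →
    DoubleNegation (HasTCycle G T (λ v → VG G H R B v ⊎ v ≡ x))
  two-grandchildren⇒T-cycle c≢c' c∈B (c-grandchild , _ , _ , p~x , P , v , v∈P , v∈T)
                                c'∈B (c'-grandchild , _ , _ , p'~x , P' , v' , v'∈P' , v'∈T) k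
    with grandchild-via c-grandchild | grandchild-via c'-grandchild | fromPath P | fromPath P'
  ... | _ , gc | _ , gc' | Pc , Pc-unique , P⊑Pc | P'c , P'c-unique , P'⊑P'c =
    parent-block⊴ c≢c' gc gc' c∈B c'∈B (lookupᶜ P'c (first∈ P'c)) λ S₁⊴B →
    parent-block⊴ (c≢c' ∘ sym) gc' gc c'∈B c∈B (lookupᶜ Pc (first∈ Pc)) λ S₂⊴B →
    let (cs , cycle , Pc⊑cs , P'c⊑cs) = grandchildren-cycle c≢c' gc gc' S₁⊴B S₂⊴B p~x p'~x Pc Pc-unique P'c P'c-unique
        v≢v' : v ≢ v'
        v≢v' = λ { refl → grandchild-vertices-disjoint c≢c' gc gc' (lookupᶜ Pc (P⊑Pc v∈P)) (lookupᶜ P'c (P'⊑P'c v'∈P')) }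
    in k (cs , cycle , v , v' , Pc⊑cs (P⊑Pc v∈P) , P'c⊑cs (P'⊑P'c v'∈P') , v≢v' , v∈T , v'∈T)

proposition4p3 : ∀ {n : ℕ} (G : Graph n) (T : Subset n) (x : Fin n)
  → MultiwayNearSeparator G T (λ v → v ≡ x)
  → (R : Rooting G (λ v → v ≢ x))
  → (t : Fin n) → t ∈ T → IsCutVertex G (λ v → v ≢ x) t
  → (B : Node n) → InSubtree G (λ v → v ≢ x) R B (cut t)
  → ¬ HasTCycle G T (λ v → VG G (λ v → v ≢ x) R B v ⊎ v ≡ x)
  → ∀ c c'
  → VG G (λ v → v ≢ x) R B c → InC≥1 G (λ v → v ≢ x) R T x t c
  → VG G (λ v → v ≢ x) R B c' → InC≥1 G (λ v → v ≢ x) R T x t c'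
  → c ≡ c'
proposition4p3 G T x _ R t _ _ B _ no-T-cycle c c' c∈B c∈C≥1 c'∈B c'∈C≥1 with c ≟ c'
... | yes c≡c' = c≡c'
... | no c≢c'  = ⊥-elim (Grandchildren.two-grandchildren⇒T-cycle G x R t c≢c' c∈B c∈C≥1 c'∈B c'∈C≥1 no-T-cycle)
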